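{- A term covered by reducible terms is reducible: if $t\in\mathrm{Tm}(\Gamma,A)$ is covered by the predicate family $(\Delta,u)\mapsto$ "$u$ is reducible at $A$ in $\Delta$", then $t$ is reducible at $A$ in $\Gamma$.
   Context: Simply-typed $\lambda$-calculus with sums (types base, $\top,\times,\to,\bot,+$). Reduction $\twoheadrightarrow$: reflexive-transitive closure of congruence closure of $\beta$-rules and commuting conversions ($e[\mathrm{raise}\,t]\to\mathrm{raise}\,t$, $e[\mathrm{case}\ s\ (x.b_l)\ (x.b_r)]\to\mathrm{case}\ s\ (x.e[b_l])\ (x.e[b_r])$ for eliminations $e::=\square\,u\mid\pi_i\square\mid\mathrm{case}\ \square\ (x.u)\ (x.u')$). Normal $\Gamma\vdash t\Leftarrow A$ / neutral $\Gamma\vdash t\Rightarrow A$ as in the bidirectional system (checking: constructors, demotion, $\mathrm{raise}$ of a neutral of type $\bot$, case on a neutral of sum type with checking branches; inferring: constants, variables, projections, application of neutral to normal). Covering: $t\in\mathrm{Tm}(\Gamma,A)$ is covered by $F$ if $F(\Gamma,t)$, or $t=\mathrm{raise}\,n$ with $\Gamma\vdash n\Rightarrow\bot$, or $t=\mathrm{case}\ n\ (x.b_l)\ (x.b_r)$ with $\Gamma\vdash n\Rightarrow A_1+A_2$ and $b_l,b_r$ covered in $\Gamma.(x:A_1)$, $\Gamma.(x:A_2)$. Values (induction on types): raw value at $T$: neutral if $T$ base or $\bot$; neutral or $\star$ if $T=\top$; neutral, $\mathrm{inl}\,a$ or $\mathrm{inr}\,b$ with $a,b$ values if $T=A+B$.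 Value at $T$ in $\Gamma$: positive $T$: covered by raw values; $\top$: normal; $A_1\times A_2$: normal with $\pi_iv$ reducible at $A_i$; $A\to B$: normal and for every $\Delta$, renaming $\rho\in\mathrm{Ren}(\Delta,\Gamma)$, value $u$ at $A$ in $\Delta$, $v[\rho]\,u$ reducible at $B$ in $\Delta$. Reducible at $T$: reduces to a value at $T$. -}

module Defs where

open import Data.Product using (Σ; ∃; _×_; _,_)
open import Data.Sum using (_⊎_; inj₁; inj₂)
open import Data.Unit using (⊤)
open import Data.Empty using (⊥)
open import Relation.Binary.PropositionalEquality using (_≡_)
open import Relation.Binary.Construct.Closure.ReflexiveTransitive using (Star)

infixr 7 _⇒_
infixr 8 _⊕_
infixr 9 _⊗_
data Ty (Base : Set) : Set where
  base : Base → Ty Base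
  𝟙    : Ty Base
  _⊗_  : Ty Base → Ty Base → Ty Base
  _⇒_  : Ty Base → Ty Base → Ty Base
  𝟘    : Ty Base
  _⊕_  : Ty Base → Ty Base → Ty Base

module Lang (Base : Set) (Const : Ty Base → Set) where

  infixl 5 _▸_
  data Ctx : Set where
    ∅   : Ctx
    _▸_ : Ctx → Ty Base → Ctx

  infix 4 _∋_
  data _∋_ : Ctx → Ty Base → Set where
    here  : ∀ {Γ A} → Γ ▸ A ∋ A
    there : ∀ {Γ A B} → Γ ∋ A → Γ ▸ B ∋ A

  data Tm (Γ : Ctx) : Ty Base → Set where
    var   : ∀ {A} → Γ ∋ A → Tm Γ A
    const : ∀ {A} → Const A → Tm Γ A
    star  : Tm Γ 𝟙
    pair  : ∀ {A B} → Tm Γ A → Tm Γ B → Tm Γ (A ⊗ B)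
    fst   : ∀ {A B} → Tm Γ (A ⊗ B) → Tm Γ A
    snd   : ∀ {A B} → Tm Γ (A ⊗ B) → Tm Γ B
    lam   : ∀ {A B} → Tm (Γ ▸ A) B → Tm Γ (A ⇒ B)
    app   : ∀ {A B} → Tm Γ (A ⇒ B) → Tm Γ A → Tm Γ B
    raise : ∀ {A} → Tm Γ 𝟘 → Tm Γ A
    inl   : ∀ {A B} → Tm Γ A → Tm Γ (A ⊕ B)
    inr   : ∀ {A B} → Tm Γ B → Tm Γ (A ⊕ B)
    case  : ∀ {A B C} → Tm Γ (A ⊕ B) → Tm (Γ ▸ A) C → Tm (Γ ▸ B) C → Tm Γ C

  Ren : Ctx → Ctx → Set
  Ren Δ Γ = ∀ {A} → Γ ∋ A → Δ ∋ A

  ext : ∀ {Γ Δ B} → Ren Δ Γ → Ren (Δ ▸ B) (Γ ▸ B)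
  ext ρ here      = here
  ext ρ (there x) = there (ρ x)

  ren : ∀ {Γ Δ A} → Ren Δ Γ → Tm Γ A → Tm Δ A
  ren ρ (var x)      = var (ρ x)
  ren ρ (const c)    = const c
  ren ρ star         = star
  ren ρ (pair a b)   = pair (ren ρ a) (ren ρ b)
  ren ρ (fst t)      = fst (ren ρ t)
  ren ρ (snd t)      = snd (ren ρ t)
  ren ρ (lam t)      = lam (ren (ext ρ) t)
  ren ρ (app t u)    = app (ren ρ t) (ren ρ u)
  ren ρ (raise t)    = raise (ren ρ t)
  ren ρ (inl t)      = inl (ren ρ t)
  ren ρ (inr t)      = inr (ren ρ t)
  ren ρ (case s l r) = case (ren ρ s) (ren (ext ρ) l) (ren (ext ρ) r)

  wk : ∀ {Γ B} → Ren (Γ ▸ B) Γ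
  wk = there

  Sub : Ctx → Ctx → Set
  Sub Δ Γ = ∀ {A} → Γ ∋ A → Tm Δ A

  exts : ∀ {Γ Δ B} → Sub Δ Γ → Sub (Δ ▸ B) (Γ ▸ B)
  exts σ here      = var here
  exts σ (there x) = ren wk (σ x)

  sub : ∀ {Γ Δ A} → Sub Δ Γ → Tm Γ A → Tm Δ A
  sub σ (var x)      = σ x
  sub σ (const c)    = const c
  sub σ star         = star
  sub σ (pair a b)   = pair (sub σ a) (sub σ b)
  sub σ (fst t)      = fst (sub σ t)
  sub σ (snd t)      = snd (sub σ t)
  sub σ (lam t)      = lam (sub (exts σ) t)
  sub σ (app t u)    = app (sub σ t) (sub σ u)
  sub σ (raise t)    = raise (sub σ t)
  sub σ (inl t)      = inl (sub σ t)
  sub σ (inr t)      = inr (sub σ t)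
  sub σ (case s l r) = case (sub σ s) (sub (exts σ) l) (sub (exts σ) r)

  _[_] : ∀ {Γ A B} → Tm (Γ ▸ A) B → Tm Γ A → Tm Γ B
  _[_] {Γ} {A} t u = sub σ t
    where
      σ : Sub Γ (Γ ▸ A)
      σ here      = u
      σ (there x) = var x

  data Elim (Γ : Ctx) : Ty Base → Ty Base → Set where
    eapp  : ∀ {A B} → Tm Γ A → Elim Γ (A ⇒ B) B
    efst  : ∀ {A B} → Elim Γ (A ⊗ B) A
    esnd  : ∀ {A B} → Elim Γ (A ⊗ B) B
    ecase : ∀ {A B C} → Tm (Γ ▸ A) C → Tm (Γ ▸ B) C → Elim Γ (A ⊕ B) C

  plug : ∀ {Γ A B} → Elim Γ A B → Tm Γ A → Tm Γ B
  plug (eapp u)    t = app t u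
  plug efst        t = fst t
  plug esnd        t = snd t
  plug (ecase l r) t = case t l r

  wkE : ∀ {Γ A B D} → Elim Γ A B → Elim (Γ ▸ D) A B
  wkE (eapp u)    = eapp (ren wk u)
  wkE efst        = efst
  wkE esnd        = esnd
  wkE (ecase l r) = ecase (ren (ext wk) l) (ren (ext wk) r)

  infix 3 _⟶_
  data _⟶_ {Γ : Ctx} : ∀ {A} → Tm Γ A → Tm Γ A → Set where
    β-lam   : ∀ {A B} {t : Tm (Γ ▸ A) B} {u} → app (lam t) u ⟶ t [ u ]
    β-fst   : ∀ {A B} {a : Tm Γ A} {b : Tm Γ B} → fst (pair a b) ⟶ a
    β-snd   : ∀ {A B} {a : Tm Γ A} {b : Tm Γ B} → snd (pair a b) ⟶ b
    β-inl   : ∀ {A B C} {a : Tm Γ A} {l : Tm (Γ ▸ A) C} {r : Tm (Γ ▸ B) C} →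
              case (inl a) l r ⟶ l [ a ]
    β-inr   : ∀ {A B C} {b : Tm Γ B} {l : Tm (Γ ▸ A) C} {r : Tm (Γ ▸ B) C} →
              case (inr b) l r ⟶ r [ b ]
    cc-raise : ∀ {A B} (e : Elim Γ A B) {t : Tm Γ 𝟘} → plug e (raise t) ⟶ raise t
    cc-case  : ∀ {A₁ A₂ A B} (e : Elim Γ A B) {s : Tm Γ (A₁ ⊕ A₂)}
               {l : Tm (Γ ▸ A₁) A} {r : Tm (Γ ▸ A₂) A} →
               plug e (case s l r) ⟶ case s (plug (wkE e) l) (plug (wkE e) r)
    ξ-pairˡ : ∀ {A B} {a a' : Tm Γ A} {b : Tm Γ B} → a ⟶ a' → pair a b ⟶ pair a' b
    ξ-pairʳ : ∀ {A B} {a : Tm Γ A} {b b' : Tm Γ B} → b ⟶ b' → pair a b ⟶ pair a b'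
    ξ-fst   : ∀ {A B} {t t' : Tm Γ (A ⊗ B)} → t ⟶ t' → fst t ⟶ fst t'
    ξ-snd   : ∀ {A B} {t t' : Tm Γ (A ⊗ B)} → t ⟶ t' → snd t ⟶ snd t'
    ξ-lam   : ∀ {A B} {t t' : Tm (Γ ▸ A) B} → t ⟶ t' → lam t ⟶ lam t'
    ξ-appˡ  : ∀ {A B} {t t' : Tm Γ (A ⇒ B)} {u} → t ⟶ t' → app t u ⟶ app t' u
    ξ-appʳ  : ∀ {A B} {t : Tm Γ (A ⇒ B)} {u u'} → u ⟶ u' → app t u ⟶ app t u'
    ξ-raise : ∀ {A} {t t' : Tm Γ 𝟘} → t ⟶ t' → raise {A = A} t ⟶ raise t'
    ξ-inl   : ∀ {A B} {t t' : Tm Γ A} → t ⟶ t' → inl {B = B} t ⟶ inl t'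
    ξ-inr   : ∀ {A B} {t t' : Tm Γ B} → t ⟶ t' → inr {A = A} t ⟶ inr t'
    ξ-caseˢ : ∀ {A B C} {s s' : Tm Γ (A ⊕ B)} {l : Tm (Γ ▸ A) C} {r : Tm (Γ ▸ B) C} →
              s ⟶ s' → case s l r ⟶ case s' l r
    ξ-caseˡ : ∀ {A B C} {s : Tm Γ (A ⊕ B)} {l l' : Tm (Γ ▸ A) C} {r : Tm (Γ ▸ B) C} →
              l ⟶ l' → case s l r ⟶ case s l' r
    ξ-caseʳ : ∀ {A B C} {s : Tm Γ (A ⊕ B)} {l : Tm (Γ ▸ A) C} {r r' : Tm (Γ ▸ B) C} →
              r ⟶ r' → case s l r ⟶ case s l r'

  infix 3 _↠_
  _↠_ : ∀ {Γ A} → Tm Γ A → Tm Γ A → Set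
  _↠_ = Star _⟶_

  data Nf : ∀ Γ A → Tm Γ A → Set
  data Ne : ∀ Γ A → Tm Γ A → Set

  data Ne where
    ne-var   : ∀ {Γ A} (x : Γ ∋ A) → Ne Γ A (var x)
    ne-const : ∀ {Γ A} (c : Const A) → Ne Γ A (const c)
    ne-fst   : ∀ {Γ A B} {n : Tm Γ (A ⊗ B)} → Ne Γ (A ⊗ B) n → Ne Γ A (fst n)
    ne-snd   : ∀ {Γ A B} {n : Tm Γ (A ⊗ B)} → Ne Γ (A ⊗ B) n → Ne Γ B (snd n)
    ne-app   : ∀ {Γ A B} {n : Tm Γ (A ⇒ B)} {v : Tm Γ A} →
               Ne Γ (A ⇒ B) n → Nf Γ A v → Ne Γ B (app n v)

  data Nf where
    nf-star  : ∀ {Γ} → Nf Γ 𝟙 star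
    nf-pair  : ∀ {Γ A B} {a : Tm Γ A} {b : Tm Γ B} → Nf Γ A a → Nf Γ B b → Nf Γ (A ⊗ B) (pair a b)
    nf-lam   : ∀ {Γ A B} {t : Tm (Γ ▸ A) B} → Nf (Γ ▸ A) B t → Nf Γ (A ⇒ B) (lam t)
    nf-inl   : ∀ {Γ A B} {a : Tm Γ A} → Nf Γ A a → Nf Γ (A ⊕ B) (inl a)
    nf-inr   : ∀ {Γ A B} {b : Tm Γ B} → Nf Γ B b → Nf Γ (A ⊕ B) (inr b)
    nf-ne    : ∀ {Γ A} {n : Tm Γ A} → Ne Γ A n → Nf Γ A n
    nf-raise : ∀ {Γ A} {n : Tm Γ 𝟘} → Ne Γ 𝟘 n → Nf Γ A (raise n)
    nf-case  : ∀ {Γ A₁ A₂ C} {n : Tm Γ (A₁ ⊕ A₂)} {l : Tm (Γ ▸ A₁) C} {r : Tm (Γ ▸ A₂) C} →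
               Ne Γ (A₁ ⊕ A₂) n → Nf (Γ ▸ A₁) C l → Nf (Γ ▸ A₂) C r → Nf Γ C (case n l r)

  data Covered {A : Ty Base} (F : ∀ Δ → Tm Δ A → Set) : ∀ Γ → Tm Γ A → Set where
    cov-base  : ∀ {Γ t} → F Γ t → Covered F Γ t
    cov-raise : ∀ {Γ} {n : Tm Γ 𝟘} → Ne Γ 𝟘 n → Covered F Γ (raise n)
    cov-case  : ∀ {Γ A₁ A₂} {n : Tm Γ (A₁ ⊕ A₂)} {l : Tm (Γ ▸ A₁) A} {r : Tm (Γ ▸ A₂) A} →
                Ne Γ (A₁ ⊕ A₂) n → Covered F (Γ ▸ A₁) l → Covered F (Γ ▸ A₂) r →
                Covered F Γ (case n l r)

  RawVal : ∀ T Γ → Tm Γ T → Set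
  Val    : ∀ T Γ → Tm Γ T → Set
  Red    : ∀ T Γ → Tm Γ T → Set

  RawVal (base b) Γ t = Ne Γ (base b) t
  RawVal 𝟘 Γ t        = Ne Γ 𝟘 t
  RawVal 𝟙 Γ t        = Ne Γ 𝟙 t ⊎ t ≡ star
  RawVal (A ⊕ B) Γ t  = Ne Γ (A ⊕ B) t
                        ⊎ (Σ (Tm Γ A) λ a → t ≡ inl a × Val A Γ a)
                        ⊎ (Σ (Tm Γ B) λ b → t ≡ inr b × Val B Γ b)
  RawVal (A ⊗ B) Γ t  = ⊥   -- not used (raw values only at positive types and ⊤)
  RawVal (A ⇒ B) Γ t  = ⊥   -- not used

  Val (base b) Γ t = Covered (RawVal (base b)) Γ t
  Val 𝟘 Γ t        = Covered (RawVal 𝟘) Γ t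
  Val (A ⊕ B) Γ t  = Covered (RawVal (A ⊕ B)) Γ t
  Val 𝟙 Γ t        = Nf Γ 𝟙 t
  Val (A ⊗ B) Γ t  = Nf Γ (A ⊗ B) t × Red A Γ (fst t) × Red B Γ (snd t)
  Val (A ⇒ B) Γ t  = Nf Γ (A ⇒ B) t ×
                     (∀ Δ (ρ : Ren Δ Γ) (u : Tm Δ A) → Val A Δ u → Red B Δ (app (ren ρ t) u))

  Red T Γ t = Σ (Tm Γ T) λ v → (t ↠ v) × Val T Γ v

-- Reducibility is closed under both covering constructors because raise n and
-- case n l r are themselves values at every type once their branches are: at
-- positive types and ⊤ this is immediate from the definitions, and at products
-- and arrows the commuting conversions absorb an elimination into raise n, or
-- push it into the branches of case n l r, where it is again reducible.  For
-- arrows the argument has to be weakened into the branches, so values must be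
-- stable under renaming (Kripke monotonicity).
module Submission where

open import Defs
open import Data.Product using (_,_)
open import Data.Sum using (inj₁; inj₂)
open import Relation.Binary.PropositionalEquality
  using (_≡_; refl; sym; trans; cong; cong₂; subst; subst₂)
open import Relation.Binary.Construct.Closure.ReflexiveTransitive using (ε; _◅_; _◅◅_; gmap)

module Reducibility (Base : Set) (Const : Ty Base → Set) where
  open Lang Base Const

  infix 4 _≗ʳ_ _≗ˢ_
  infixr 9 _∘ʳ_

  _≗ʳ_ : ∀ {Γ Δ} → Ren Δ Γ → Ren Δ Γ → Set
  _≗ʳ_ {Γ} ρ ρ' = ∀ {A} (x : Γ ∋ A) → ρ x ≡ ρ' x

  _≗ˢ_ : ∀ {Γ Δ} → Sub Δ Γ → Sub Δ Γ → Set
  _≗ˢ_ {Γ} σ σ' = ∀ {A} (x : Γ ∋ A) → σ x ≡ σ' x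

  _∘ʳ_ : ∀ {Γ Δ Θ} → Ren Θ Δ → Ren Δ Γ → Ren Θ Γ
  (ρ ∘ʳ σ) x = ρ (σ x)

  case-cong : ∀ {Γ A B C} {s s' : Tm Γ (A ⊕ B)} {l l' : Tm (Γ ▸ A) C} {r r' : Tm (Γ ▸ B) C} →
              s ≡ s' → l ≡ l' → r ≡ r' → case s l r ≡ case s' l' r'
  case-cong refl refl refl = refl

  ext-∘ : ∀ {Γ Δ Θ B} {ρ : Ren Θ Δ} {σ : Ren Δ Γ} {τ : Ren Θ Γ} →
          ρ ∘ʳ σ ≗ʳ τ → ext {B = B} ρ ∘ʳ ext σ ≗ʳ ext τ
  ext-∘ p here      = refl
  ext-∘ p (there x) = cong there (p x)

  ren-ren : ∀ {Γ Δ Θ A} {ρ : Ren Θ Δ} {σ : Ren Δ Γ} {τ : Ren Θ Γ} →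
            ρ ∘ʳ σ ≗ʳ τ → (t : Tm Γ A) → ren ρ (ren σ t) ≡ ren τ t
  ren-ren p (var x)      = cong var (p x)
  ren-ren p (const c)    = refl
  ren-ren p star         = refl
  ren-ren p (pair a b)   = cong₂ pair (ren-ren p a) (ren-ren p b)
  ren-ren p (fst t)      = cong fst (ren-ren p t)
  ren-ren p (snd t)      = cong snd (ren-ren p t)
  ren-ren p (lam t)      = cong lam (ren-ren (ext-∘ p) t)
  ren-ren p (app t u)    = cong₂ app (ren-ren p t) (ren-ren p u)
  ren-ren p (raise t)    = cong raise (ren-ren p t)
  ren-ren p (inl t)      = cong inl (ren-ren p t)
  ren-ren p (inr t)      = cong inr (ren-ren p t)
  ren-ren p (case s l r) = case-cong (ren-ren p s) (ren-ren (ext-∘ p) l) (ren-ren (ext-∘ p) r)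

  ren-square : ∀ {Γ Δ Δ' Θ A} {ρ : Ren Θ Δ} {σ : Ren Δ Γ} {σ' : Ren Θ Δ'} {ρ' : Ren Δ' Γ} →
               ρ ∘ʳ σ ≗ʳ σ' ∘ʳ ρ' → (t : Tm Γ A) → ren ρ (ren σ t) ≡ ren σ' (ren ρ' t)
  ren-square p t = trans (ren-ren p t) (sym (ren-ren (λ _ → refl) t))

  ext-wk : ∀ {Γ Δ B} (ρ : Ren Δ Γ) → ext {B = B} ρ ∘ʳ wk ≗ʳ wk ∘ʳ ρ
  ext-wk ρ x = refl

  ren-exts : ∀ {Γ Δ Θ B} {ρ : Ren Θ Δ} {σ : Sub Δ Γ} {τ : Sub Θ Γ} →
             (λ x → ren ρ (σ x)) ≗ˢ τ → (λ x → ren (ext {B = B} ρ) (exts σ x)) ≗ˢ exts τ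
  ren-exts p here                  = refl
  ren-exts {ρ = ρ} {σ} p (there x) = trans (ren-square (ext-wk ρ) (σ x)) (cong (ren wk) (p x))

  ren-sub : ∀ {Γ Δ Θ A} {ρ : Ren Θ Δ} {σ : Sub Δ Γ} {τ : Sub Θ Γ} →
            (λ x → ren ρ (σ x)) ≗ˢ τ → (t : Tm Γ A) → ren ρ (sub σ t) ≡ sub τ t
  ren-sub p (var x)      = p x
  ren-sub p (const c)    = refl
  ren-sub p star         = refl
  ren-sub p (pair a b)   = cong₂ pair (ren-sub p a) (ren-sub p b)
  ren-sub p (fst t)      = cong fst (ren-sub p t)
  ren-sub p (snd t)      = cong snd (ren-sub p t)
  ren-sub p (lam t)      = cong lam (ren-sub (ren-exts p) t)
  ren-sub p (app t u)    = cong₂ app (ren-sub p t) (ren-sub p u)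
  ren-sub p (raise t)    = cong raise (ren-sub p t)
  ren-sub p (inl t)      = cong inl (ren-sub p t)
  ren-sub p (inr t)      = cong inr (ren-sub p t)
  ren-sub p (case s l r) = case-cong (ren-sub p s) (ren-sub (ren-exts p) l) (ren-sub (ren-exts p) r)

  exts-ext : ∀ {Γ Δ Θ B} {σ : Sub Θ Δ} {ρ : Ren Δ Γ} {τ : Sub Θ Γ} →
             (λ x → σ (ρ x)) ≗ˢ τ → (λ x → exts {B = B} σ (ext ρ x)) ≗ˢ exts τ
  exts-ext p here      = refl
  exts-ext p (there x) = cong (ren wk) (p x)

  sub-ren : ∀ {Γ Δ Θ A} {σ : Sub Θ Δ} {ρ : Ren Δ Γ} {τ : Sub Θ Γ} →
            (λ x → σ (ρ x)) ≗ˢ τ → (t : Tm Γ A) → sub σ (ren ρ t) ≡ sub τ t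
  sub-ren p (var x)      = p x
  sub-ren p (const c)    = refl
  sub-ren p star         = refl
  sub-ren p (pair a b)   = cong₂ pair (sub-ren p a) (sub-ren p b)
  sub-ren p (fst t)      = cong fst (sub-ren p t)
  sub-ren p (snd t)      = cong snd (sub-ren p t)
  sub-ren p (lam t)      = cong lam (sub-ren (exts-ext p) t)
  sub-ren p (app t u)    = cong₂ app (sub-ren p t) (sub-ren p u)
  sub-ren p (raise t)    = cong raise (sub-ren p t)
  sub-ren p (inl t)      = cong inl (sub-ren p t)
  sub-ren p (inr t)      = cong inr (sub-ren p t)
  sub-ren p (case s l r) = case-cong (sub-ren p s) (sub-ren (exts-ext p) l) (sub-ren (exts-ext p) r)

  ren-sub-square : ∀ {Γ Γ' Δ Δ' A} {ρ : Ren Δ' Δ} {σ : Sub Δ Γ} {σ' : Sub Δ' Γ'} {ρ' : Ren Γ' Γ} →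
                   (λ x → ren ρ (σ x)) ≗ˢ (λ x → σ' (ρ' x)) →
                   (t : Tm Γ A) → ren ρ (sub σ t) ≡ sub σ' (ren ρ' t)
  ren-sub-square p t = trans (ren-sub p t) (sym (sub-ren (λ _ → refl) t))

  ren-[] : ∀ {Γ Δ A B} (ρ : Ren Δ Γ) (t : Tm (Γ ▸ A) B) (u : Tm Γ A) →
           ren ρ (t [ u ]) ≡ ren (ext ρ) t [ ren ρ u ]
  ren-[] ρ t u = ren-sub-square (λ { here → refl ; (there x) → refl }) t

  renE : ∀ {Γ Δ A B} → Ren Δ Γ → Elim Γ A B → Elim Δ A B
  renE ρ (eapp u)    = eapp (ren ρ u)
  renE ρ efst        = efst
  renE ρ esnd        = esnd
  renE ρ (ecase l r) = ecase (ren (ext ρ) l) (ren (ext ρ) r)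

  ren-plug : ∀ {Γ Δ A B} (ρ : Ren Δ Γ) (e : Elim Γ A B) (t : Tm Γ A) →
             ren ρ (plug e t) ≡ plug (renE ρ e) (ren ρ t)
  ren-plug ρ (eapp u)    t = refl
  ren-plug ρ efst        t = refl
  ren-plug ρ esnd        t = refl
  ren-plug ρ (ecase l r) t = refl

  renE-wkE : ∀ {Γ Δ A B D} (ρ : Ren Δ Γ) (e : Elim Γ A B) →
             renE (ext {B = D} ρ) (wkE e) ≡ wkE (renE ρ e)
  renE-wkE ρ (eapp u)    = cong eapp (ren-square (ext-wk ρ) u)
  renE-wkE ρ efst        = refl
  renE-wkE ρ esnd        = refl
  renE-wkE ρ (ecase l r) = cong₂ ecase (ren-square ext²-ext-wk l) (ren-square ext²-ext-wk r)
    where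
      ext²-ext-wk : ∀ {E} → ext (ext ρ) ∘ʳ ext {B = E} wk ≗ʳ ext wk ∘ʳ ext ρ
      ext²-ext-wk here      = refl
      ext²-ext-wk (there x) = refl

  ren-⟶ : ∀ {Γ Δ A} (ρ : Ren Δ Γ) {t t' : Tm Γ A} → t ⟶ t' → ren ρ t ⟶ ren ρ t'
  ren-⟶ ρ (β-lam {t = t} {u})        = subst₂ _⟶_ refl (sym (ren-[] ρ t u)) β-lam
  ren-⟶ ρ β-fst                      = β-fst
  ren-⟶ ρ β-snd                      = β-snd
  ren-⟶ ρ (β-inl {a = a} {l})        = subst₂ _⟶_ refl (sym (ren-[] ρ l a)) β-inl
  ren-⟶ ρ (β-inr {b = b} {r = r})    = subst₂ _⟶_ refl (sym (ren-[] ρ r b)) β-inr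
  ren-⟶ ρ (cc-raise e)               = subst₂ _⟶_ (sym (ren-plug ρ e _)) refl (cc-raise (renE ρ e))
  ren-⟶ ρ (cc-case e {s} {l} {r})    =
    subst₂ _⟶_ (sym (ren-plug ρ e _)) (cong₂ (case (ren ρ s)) (ren-branch l) (ren-branch r))
           (cc-case (renE ρ e))
    where
      ren-branch : ∀ {E} (b : Tm (_ ▸ E) _) →
                   plug (wkE (renE ρ e)) (ren (ext ρ) b) ≡ ren (ext ρ) (plug (wkE e) b)
      ren-branch b = trans (cong (λ e' → plug e' (ren (ext ρ) b)) (sym (renE-wkE ρ e)))
                           (sym (ren-plug (ext ρ) (wkE e) b))
  ren-⟶ ρ (ξ-pairˡ s)                = ξ-pairˡ (ren-⟶ ρ s)
  ren-⟶ ρ (ξ-pairʳ s)                = ξ-pairʳ (ren-⟶ ρ s)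
  ren-⟶ ρ (ξ-fst s)                  = ξ-fst (ren-⟶ ρ s)
  ren-⟶ ρ (ξ-snd s)                  = ξ-snd (ren-⟶ ρ s)
  ren-⟶ ρ (ξ-lam s)                  = ξ-lam (ren-⟶ (ext ρ) s)
  ren-⟶ ρ (ξ-appˡ s)                 = ξ-appˡ (ren-⟶ ρ s)
  ren-⟶ ρ (ξ-appʳ s)                 = ξ-appʳ (ren-⟶ ρ s)
  ren-⟶ ρ (ξ-raise s)                = ξ-raise (ren-⟶ ρ s)
  ren-⟶ ρ (ξ-inl s)                  = ξ-inl (ren-⟶ ρ s)
  ren-⟶ ρ (ξ-inr s)                  = ξ-inr (ren-⟶ ρ s)
  ren-⟶ ρ (ξ-caseˢ s)                = ξ-caseˢ (ren-⟶ ρ s)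
  ren-⟶ ρ (ξ-caseˡ s)                = ξ-caseˡ (ren-⟶ (ext ρ) s)
  ren-⟶ ρ (ξ-caseʳ s)                = ξ-caseʳ (ren-⟶ (ext ρ) s)

  ren-↠ : ∀ {Γ Δ A} (ρ : Ren Δ Γ) {t t' : Tm Γ A} → t ↠ t' → ren ρ t ↠ ren ρ t'
  ren-↠ ρ = gmap (ren ρ) (ren-⟶ ρ)

  case-↠ : ∀ {Γ A₁ A₂ C} {n : Tm Γ (A₁ ⊕ A₂)} {l l' : Tm (Γ ▸ A₁) C} {r r' : Tm (Γ ▸ A₂) C} →
           l ↠ l' → r ↠ r' → case n l r ↠ case n l' r'
  case-↠ {n = n} {l' = l'} {r = r} l↠l' r↠r' =
    gmap (λ l → case n l r) ξ-caseˡ l↠l' ◅◅ gmap (case n l') ξ-caseʳ r↠r'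

  ren-Ne : ∀ {Γ Δ A t} (ρ : Ren Δ Γ) → Ne Γ A t → Ne Δ A (ren ρ t)
  ren-Nf : ∀ {Γ Δ A t} (ρ : Ren Δ Γ) → Nf Γ A t → Nf Δ A (ren ρ t)
  ren-Ne ρ (ne-var x)      = ne-var (ρ x)
  ren-Ne ρ (ne-const c)    = ne-const c
  ren-Ne ρ (ne-fst n)      = ne-fst (ren-Ne ρ n)
  ren-Ne ρ (ne-snd n)      = ne-snd (ren-Ne ρ n)
  ren-Ne ρ (ne-app n v)    = ne-app (ren-Ne ρ n) (ren-Nf ρ v)
  ren-Nf ρ nf-star         = nf-star
  ren-Nf ρ (nf-pair a b)   = nf-pair (ren-Nf ρ a) (ren-Nf ρ b)
  ren-Nf ρ (nf-lam t)      = nf-lam (ren-Nf (ext ρ) t)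
  ren-Nf ρ (nf-inl t)      = nf-inl (ren-Nf ρ t)
  ren-Nf ρ (nf-inr t)      = nf-inr (ren-Nf ρ t)
  ren-Nf ρ (nf-ne n)       = nf-ne (ren-Ne ρ n)
  ren-Nf ρ (nf-raise n)    = nf-raise (ren-Ne ρ n)
  ren-Nf ρ (nf-case n l r) = nf-case (ren-Ne ρ n) (ren-Nf (ext ρ) l) (ren-Nf (ext ρ) r)

  ren-Covered : ∀ {A} {F : ∀ Δ → Tm Δ A → Set} →
                (∀ {Γ Δ t} (ρ : Ren Δ Γ) → F Γ t → F Δ (ren ρ t)) →
                ∀ {Γ Δ t} (ρ : Ren Δ Γ) → Covered F Γ t → Covered F Δ (ren ρ t)
  ren-Covered ren-F ρ (cov-base x)     = cov-base (ren-F ρ x)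
  ren-Covered ren-F ρ (cov-raise n)    = cov-raise (ren-Ne ρ n)
  ren-Covered ren-F ρ (cov-case n l r) =
    cov-case (ren-Ne ρ n) (ren-Covered ren-F (ext ρ) l) (ren-Covered ren-F (ext ρ) r)

  ren-RawVal : ∀ T {Γ Δ t} (ρ : Ren Δ Γ) → RawVal T Γ t → RawVal T Δ (ren ρ t)
  ren-Val    : ∀ T {Γ Δ t} (ρ : Ren Δ Γ) → Val T Γ t → Val T Δ (ren ρ t)
  ren-Red    : ∀ T {Γ Δ t} (ρ : Ren Δ Γ) → Red T Γ t → Red T Δ (ren ρ t)

  ren-RawVal (base b) ρ n                             = ren-Ne ρ n
  ren-RawVal 𝟘        ρ n                             = ren-Ne ρ n
  ren-RawVal 𝟙        ρ (inj₁ n)                      = inj₁ (ren-Ne ρ n)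
  ren-RawVal 𝟙        ρ (inj₂ refl)                   = inj₂ refl
  ren-RawVal (A ⊕ B)  ρ (inj₁ n)                      = inj₁ (ren-Ne ρ n)
  ren-RawVal (A ⊕ B)  ρ (inj₂ (inj₁ (a , refl , v)))  = inj₂ (inj₁ (ren ρ a , refl , ren-Val A ρ v))
  ren-RawVal (A ⊕ B)  ρ (inj₂ (inj₂ (b , refl , v)))  = inj₂ (inj₂ (ren ρ b , refl , ren-Val B ρ v))

  ren-Val (base b) ρ v            = ren-Covered (ren-RawVal (base b)) ρ v
  ren-Val 𝟘        ρ v            = ren-Covered (ren-RawVal 𝟘) ρ v
  ren-Val (A ⊕ B)  ρ v            = ren-Covered (ren-RawVal (A ⊕ B)) ρ v
  ren-Val 𝟙        ρ v            = ren-Nf ρ v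
  ren-Val (A ⊗ B)  ρ (v , a , b)  = ren-Nf ρ v , ren-Red A ρ a , ren-Red B ρ b
  ren-Val (A ⇒ B) {t = t} ρ (v , app-Red) =
    ren-Nf ρ v ,
    λ Δ ρ' u u-Val → subst (λ f → Red B Δ (app f u)) (sym (ren-ren (λ _ → refl) t)) (app-Red Δ (ρ' ∘ʳ ρ) u u-Val)

  ren-Red T ρ (v , t↠v , v-Val) = ren ρ v , ren-↠ ρ t↠v , ren-Val T ρ v-Val

  ⟶-Red : ∀ {T Γ} {t t' : Tm Γ T} → t ⟶ t' → Red T Γ t' → Red T Γ t
  ⟶-Red t⟶t' (v , t'↠v , v-Val) = v , t⟶t' ◅ t'↠v , v-Val

  raise-Val : ∀ T {Γ n} → Ne Γ 𝟘 n → Val T Γ (raise n)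
  raise-Red : ∀ T {Γ n} → Ne Γ 𝟘 n → Red T Γ (raise n)
  raise-Val (base b) n = cov-raise n
  raise-Val 𝟘        n = cov-raise n
  raise-Val (A ⊕ B)  n = cov-raise n
  raise-Val 𝟙        n = nf-raise n
  raise-Val (A ⊗ B)  n =
    nf-raise n , ⟶-Red (cc-raise efst) (raise-Red A n) , ⟶-Red (cc-raise esnd) (raise-Red B n)
  raise-Val (A ⇒ B)  n =
    nf-raise n , λ Δ ρ u _ → ⟶-Red (cc-raise (eapp u)) (raise-Red B (ren-Ne ρ n))
  raise-Red T n = _ , ε , raise-Val T n

  case-Val : ∀ T {Γ A₁ A₂} {n : Tm Γ (A₁ ⊕ A₂)} {l r} → Ne Γ (A₁ ⊕ A₂) n →
             Val T (Γ ▸ A₁) l → Val T (Γ ▸ A₂) r → Val T Γ (case n l r)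
  case-Red : ∀ T {Γ A₁ A₂} {n : Tm Γ (A₁ ⊕ A₂)} {l r} → Ne Γ (A₁ ⊕ A₂) n →
             Red T (Γ ▸ A₁) l → Red T (Γ ▸ A₂) r → Red T Γ (case n l r)
  case-Val (base b) n l r = cov-case n l r
  case-Val 𝟘        n l r = cov-case n l r
  case-Val (A ⊕ B)  n l r = cov-case n l r
  case-Val 𝟙        n l r = nf-case n l r
  case-Val (A ⊗ B)  n (l , l₁ , l₂) (r , r₁ , r₂) =
    nf-case n l r ,
    ⟶-Red (cc-case efst) (case-Red A n l₁ r₁) ,
    ⟶-Red (cc-case esnd) (case-Red B n l₂ r₂)
  case-Val (A ⇒ B)  n (l , l-app) (r , r-app) =
    nf-case n l r ,
    λ Δ ρ u u-Val →
      ⟶-Red (cc-case (eapp u))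
            (case-Red B (ren-Ne ρ n) (l-app _ (ext ρ) _ (ren-Val A wk u-Val))
                                     (r-app _ (ext ρ) _ (ren-Val A wk u-Val)))
  case-Red T n (vl , l↠vl , vl-Val) (vr , r↠vr , vr-Val) =
    case _ vl vr , case-↠ l↠vl r↠vr , case-Val T n vl-Val vr-Val

  Covered-Red⇒Red : ∀ {Γ} A {t : Tm Γ A} → Covered (λ Δ u → Red A Δ u) Γ t → Red A Γ t
  Covered-Red⇒Red A (cov-base t-Red)  = t-Red
  Covered-Red⇒Red A (cov-raise n)     = raise-Red A n
  Covered-Red⇒Red A (cov-case n l r)  = case-Red A n (Covered-Red⇒Red A l) (Covered-Red⇒Red A r)

mainTheorem14 : (Base : Set) (Const : Ty Base → Set) →
    let open Lang Base Const in
    ∀ Γ A (t : Tm Γ A) → Covered (λ Δ u → Red A Δ u) Γ t → Red A Γ t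
mainTheorem14 Base Const Γ A t = Reducibility.Covered-Red⇒Red Base Const A
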